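{- Let $n\ge 9$ and let $\mathcal{F}\subseteq\binom{[n]}{4}$ be contained in a family of the form $\mathcal{G}_3$ with center $x$ and core $E$, and put $B=\{x\}\cup E$. Let $x_1\ne x_2$ be elements of $[n]$. (i) If $d_{\{x_1,x_2\}}\ge 3n-12$, then $x\in\{x_1,x_2\}$. (ii) If $d_{\{x_1,x_2\}}>3n-12$, then $\{x_1,x_2\}\subseteq B$ and $x\in\{x_1,x_2\}$.
   Context: For a $3$-set $E\subseteq[n]$ and $x\in[n]\setminus E$, the family of the form $\mathcal{G}_3$ with center $x$ and core $E$ is $\{G\in\binom{[n]}{4}:E\subseteq G\}\cup\{G\in\binom{[n]}{4}:x\in G,\ G\cap E\ne\emptyset\}$. For $S\subseteq[n]$, $d_S$ denotes the number of members of $\mathcal{F}$ containing $S$. -}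

module Defs where

open import Data.Nat using (ℕ; zero; suc)
open import Data.Bool using (Bool; T)
open import Data.Bool.Properties using (T?)
open import Data.List using (List; []; _∷_; _++_; map; filter; length)
open import Data.Vec using (_∷_; [])
open import Data.Fin using (Fin)
open import Data.Fin.Subset using (Subset; _⊆_; _∈_; _∉_; _∩_; _∪_; ⁅_⁆; ∣_∣; Nonempty; inside; outside)
open import Data.Fin.Subset.Properties using (_⊆?_)
open import Data.Product using (_×_)
open import Data.Sum using (_⊎_)
open import Relation.Binary.PropositionalEquality using (_≡_)
open import Relation.Nullary.Decidable using (_×-dec_)

Family : ℕ → Set
Family n = Subset n → Bool

-- The list of all 2^n subsets of Fin n (each exactly once).
allSubsets : (n : ℕ) → List (Subset n)
allSubsets zero = [] ∷ []
allSubsets (suc n) = map (inside ∷_) (allSubsets n) ++ map (outside ∷_) (allSubsets n)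

Uniform4 : {n : ℕ} → Family n → Set
Uniform4 {n} F = (G : Subset n) → T (F G) → ∣ G ∣ ≡ 4

InG3 : {n : ℕ} → Fin n → Subset n → Subset n → Set
InG3 x E G = ∣ G ∣ ≡ 4 × (E ⊆ G ⊎ (x ∈ G × Nonempty (G ∩ E)))

ContainedInG3 : {n : ℕ} → Family n → Fin n → Subset n → Set
ContainedInG3 {n} F x E = (G : Subset n) → T (F G) → InG3 x E G

deg : {n : ℕ} → Family n → Subset n → ℕ
deg {n} F S = length (filter (λ G → T? (F G) ×-dec (S ⊆? G)) (allSubsets n))

-- Every member of F contains the core E or the center x, and in both cases it
-- meets E.  If x ∉ S, a member containing S is E or {x} ∪ S plus one point, so
-- d_S ≤ 2(n - 3) < 3n - 12 for n ≥ 9; this gives (i).  If S = {x, y} with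
-- y ∉ B, then S avoids E and no 4-set above S inside the complement of E is a
-- member, so d_S ≤ C(n-2,2) - C(n-5,2) = 3n - 12; this gives (ii).
module Submission where

open import Level using (Level; 0ℓ)
open import Function using (_∘_)
open import Data.Bool using (true; false; T)
open import Data.Nat using (ℕ; zero; suc; _+_; _*_; _∸_; _≤_; _<_; z≤n; s≤s)
open import Data.Nat.Properties
  using (_≟_; ≤-refl; ≤-reflexive; ≤-trans; n≤1+n; +-mono-≤; +-monoʳ-≤; +-suc; +-identityʳ;
         +-∸-assoc; ∸-+-assoc; m+n∸m≡n; m<m+n; m≤m+n; +-cancelʳ-≤; 1+n≰n; <⇒≤; <⇒≱;
         m≤n⇒∃[o]m+o≡n; module ≤-Reasoning)
open import Data.Nat.Combinatorics using (_C_; nC1≡n; nCk+nC[k+1]≡[n+1]C[k+1])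
open import Data.Nat.Tactic.RingSolver using (solve-∀)
open import Data.List using (List; []; _∷_; _++_; map; filter; length)
open import Data.List.Properties using (filter-++; length-++; filter-accept; filter-none)
open import Data.List.Relation.Unary.All using (universal)
open import Data.Vec using (_∷_; []; here; there)
open import Data.Fin using (Fin; zero; suc)
open import Data.Fin.Subset
  using (Subset; inside; outside; _∈_; _∉_; _⊆_; _∪_; _∩_; ⁅_⁆; ∁; ⊤; ∣_∣; Nonempty)
open import Data.Fin.Subset.Properties
  using (_∈?_; _⊆?_; ⊆⊤; ∣⊤∣≡n; ∣∁p∣≡n∸∣p∣; ∣⁅x⁆∣≡1; p⊆q⇒∣p∣≤∣q∣; drop-∷-⊆; ∪-comm;
         ∪-identityˡ; x∈⁅x⁆; x∈⁅y⁆⇒x≡y; x≢y⇒x∉⁅y⁆; x∈p∪q⁺; x∈p∪q⁻; x∈p∩q⁺; x∈p∩q⁻;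
         x∈p⇒x∉∁p; x∉p⇒x∈∁p)
open import Data.Product using (_×_; _,_; proj₁)
import Data.Product as Product
open import Data.Sum using (_⊎_; inj₁; inj₂; [_,_]′)
import Data.Sum as Sum
open import Relation.Nullary using (¬_; yes; no; does; contradiction)
open import Relation.Nullary.Decidable using (_×-dec_)
open import Relation.Unary using (Pred; Decidable)
open import Relation.Binary.PropositionalEquality
  using (_≡_; _≢_; refl; sym; trans; cong; cong₂; subst; ≢-sym; module ≡-Reasoning)

open import Defs

private
  variable
    a p q r : Level
    A B : Set a
    P : Pred A p
    Q : Pred A q
    R : Pred A r
    n k : ℕ

count : {P : Pred A p} → Decidable P → List A → ℕ
count P? xs = length (filter P? xs)

count-++ : (P? : Decidable P) (xs ys : List A) →
           count P? (xs ++ ys) ≡ count P? xs + count P? ys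
count-++ P? xs ys = trans (cong length (filter-++ P? xs ys)) (length-++ (filter P? xs))

count-map : (P? : Decidable P) (f : B → A) (xs : List B) →
            count P? (map f xs) ≡ count (P? ∘ f) xs
count-map P? f [] = refl
count-map P? f (x ∷ xs) with does (P? (f x))
... | true  = cong suc (count-map P? f xs)
... | false = count-map P? f xs

count-cong : (P? : Decidable P) (Q? : Decidable Q) → (∀ x → does (P? x) ≡ does (Q? x)) →
             ∀ xs → count P? xs ≡ count Q? xs
count-cong P? Q? eq [] = refl
count-cong P? Q? eq (x ∷ xs) with does (P? x) | does (Q? x) | eq x
... | true  | true  | _ = cong suc (count-cong P? Q? eq xs)
... | false | false | _ = count-cong P? Q? eq xs

count-none : (P? : Decidable P) → (∀ x → ¬ P x) → ∀ xs → count P? xs ≡ 0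
count-none P? ¬P xs = cong length (filter-none P? (universal ¬P xs))

count-accept : (P? : Decidable P) {x : A} → P x → ∀ xs → count P? (x ∷ xs) ≡ suc (count P? xs)
count-accept P? px xs = cong length (filter-accept P? px)

count≤count-∷ : (P? : Decidable P) (x : A) (xs : List A) → count P? xs ≤ count P? (x ∷ xs)
count≤count-∷ P? x xs with does (P? x)
... | true  = n≤1+n _
... | false = ≤-refl

module _ {A : Set a} {P : Pred A p} {Q : Pred A q} {R : Pred A r}
         (P? : Decidable P) (Q? : Decidable Q) (R? : Decidable R) where

  count≤count+count : (∀ {x} → P x → Q x ⊎ R x) → ∀ xs → count P? xs ≤ count Q? xs + count R? xs
  count≤count+count P⊆Q∪R [] = z≤n
  count≤count+count P⊆Q∪R (x ∷ xs) with P? x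
  ... | no _ = ≤-trans (count≤count+count P⊆Q∪R xs)
                       (+-mono-≤ (count≤count-∷ Q? x xs) (count≤count-∷ R? x xs))
  ... | yes px with Q? x | R? x | P⊆Q∪R px
  ...   | yes _ | yes _ | _ =
    s≤s (≤-trans (count≤count+count P⊆Q∪R xs) (+-monoʳ-≤ (count Q? xs) (n≤1+n _)))
  ...   | yes _ | no _  | _ = s≤s (count≤count+count P⊆Q∪R xs)
  ...   | no _  | yes _ | _ =
    ≤-trans (s≤s (count≤count+count P⊆Q∪R xs)) (≤-reflexive (sym (+-suc (count Q? xs) _)))
  ...   | no ¬q | no _  | inj₁ q = contradiction q ¬q
  ...   | no _  | no ¬r | inj₂ r = contradiction r ¬r

  count+count≤count : (∀ {x} → P x → R x) → (∀ {x} → Q x → R x) → (∀ {x} → P x → ¬ Q x) →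
                      ∀ xs → count P? xs + count Q? xs ≤ count R? xs
  count+count≤count P⊆R Q⊆R P∩Q=∅ [] = z≤n
  count+count≤count P⊆R Q⊆R P∩Q=∅ (x ∷ xs) with P? x | Q? x
  ... | yes px | yes qx = contradiction qx (P∩Q=∅ px)
  ... | yes px | no _   =
    ≤-trans (s≤s (count+count≤count P⊆R Q⊆R P∩Q=∅ xs)) (≤-reflexive (sym (count-accept R? (P⊆R px) xs)))
  ... | no _   | yes qx = begin
    count P? xs + suc (count Q? xs)  ≡⟨ +-suc (count P? xs) _ ⟩
    suc (count P? xs + count Q? xs)  ≤⟨ s≤s (count+count≤count P⊆R Q⊆R P∩Q=∅ xs) ⟩
    suc (count R? xs)                ≡⟨ count-accept R? (Q⊆R qx) xs ⟨
    count R? (x ∷ xs)                ∎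
    where open ≤-Reasoning
  ... | no _   | no _   = ≤-trans (count+count≤count P⊆R Q⊆R P∩Q=∅ xs) (count≤count-∷ R? x xs)

count-allSubsets-suc : (P? : Decidable {A = Subset (suc n)} P) →
                       count P? (allSubsets (suc n)) ≡
                       count (P? ∘ (inside ∷_)) (allSubsets n) + count (P? ∘ (outside ∷_)) (allSubsets n)
count-allSubsets-suc {n} P? =
  trans (count-++ P? (map (inside ∷_) (allSubsets n)) (map (outside ∷_) (allSubsets n)))
        (cong₂ _+_ (count-map P? (inside ∷_) (allSubsets n)) (count-map P? (outside ∷_) (allSubsets n)))

Between : Subset n → Subset n → ℕ → Pred (Subset n) 0ℓ
Between A U k G = A ⊆ G × G ⊆ U × ∣ G ∣ ≡ k

between? : (A U : Subset n) (k : ℕ) → Decidable (Between A U k)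
between? A U k G = A ⊆? G ×-dec G ⊆? U ×-dec ∣ G ∣ ≟ k

#Between : Subset n → Subset n → ℕ → ℕ
#Between {n} A U k = count (between? A U k) (allSubsets n)

#Between-< : (A U : Subset n) → k < ∣ A ∣ → #Between A U k ≡ 0
#Between-< {n} A U k<∣A∣ =
  count-none (between? A U _)
    (λ _ (A⊆G , _ , ∣G∣≡k) → 1+n≰n (≤-trans (≤-trans k<∣A∣ (p⊆q⇒∣p∣≤∣q∣ A⊆G)) (≤-reflexive ∣G∣≡k)))
    (allSubsets n)

module _ {n : ℕ} (A U : Subset n) where

  open ≡-Reasoning

  #Between-in∷in : ∀ k → #Between (inside ∷ A) (inside ∷ U) (suc k) ≡ #Between A U k
  #Between-in∷in k = begin
    #Between (inside ∷ A) (inside ∷ U) (suc k)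
      ≡⟨ count-allSubsets-suc P? ⟩
    count (P? ∘ (inside ∷_)) (allSubsets n) + count (P? ∘ (outside ∷_)) (allSubsets n)
      ≡⟨ cong₂ _+_ (count-cong (P? ∘ (inside ∷_)) (between? A U k) (λ _ → refl) (allSubsets n))
                   (count-none (P? ∘ (outside ∷_)) (λ _ (A⊆G , _) → contradiction (A⊆G here) λ ())
                               (allSubsets n)) ⟩
    #Between A U k + 0
      ≡⟨ +-identityʳ _ ⟩
    #Between A U k ∎
    where P? = between? (inside ∷ A) (inside ∷ U) (suc k)

  #Between-out∷out : ∀ k → #Between (outside ∷ A) (outside ∷ U) k ≡ #Between A U k
  #Between-out∷out k = begin
    #Between (outside ∷ A) (outside ∷ U) k
      ≡⟨ count-allSubsets-suc P? ⟩
    count (P? ∘ (inside ∷_)) (allSubsets n) + count (P? ∘ (outside ∷_)) (allSubsets n)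
      ≡⟨ cong₂ _+_ (count-none (P? ∘ (inside ∷_)) (λ _ (_ , G⊆U , _) → contradiction (G⊆U here) λ ())
                               (allSubsets n))
                   (count-cong (P? ∘ (outside ∷_)) (between? A U k) (λ _ → refl) (allSubsets n)) ⟩
    #Between A U k ∎
    where P? = between? (outside ∷ A) (outside ∷ U) k

  #Between-out∷in : ∀ k → #Between (outside ∷ A) (inside ∷ U) (suc k) ≡ #Between A U k + #Between A U (suc k)
  #Between-out∷in k = begin
    #Between (outside ∷ A) (inside ∷ U) (suc k)
      ≡⟨ count-allSubsets-suc P? ⟩
    count (P? ∘ (inside ∷_)) (allSubsets n) + count (P? ∘ (outside ∷_)) (allSubsets n)
      ≡⟨ cong₂ _+_ (count-cong (P? ∘ (inside ∷_)) (between? A U k) (λ _ → refl) (allSubsets n))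
                   (count-cong (P? ∘ (outside ∷_)) (between? A U (suc k)) (λ _ → refl) (allSubsets n)) ⟩
    #Between A U k + #Between A U (suc k) ∎
    where P? = between? (outside ∷ A) (inside ∷ U) (suc k)

  #Between-out∷in-≤ : ∀ k → k ≤ ∣ A ∣ → #Between (outside ∷ A) (inside ∷ U) k ≡ #Between A U k
  #Between-out∷in-≤ zero _ = begin
    #Between (outside ∷ A) (inside ∷ U) 0
      ≡⟨ count-allSubsets-suc P? ⟩
    count (P? ∘ (inside ∷_)) (allSubsets n) + count (P? ∘ (outside ∷_)) (allSubsets n)
      ≡⟨ cong₂ _+_ (count-none (P? ∘ (inside ∷_)) (λ { _ (_ , _ , ()) }) (allSubsets n))
                   (count-cong (P? ∘ (outside ∷_)) (between? A U 0) (λ _ → refl) (allSubsets n)) ⟩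
    #Between A U 0 ∎
    where P? = between? (outside ∷ A) (inside ∷ U) 0
  #Between-out∷in-≤ (suc k) k<∣A∣ = begin
    #Between (outside ∷ A) (inside ∷ U) (suc k)  ≡⟨ #Between-out∷in k ⟩
    #Between A U k + #Between A U (suc k)        ≡⟨ cong (_+ #Between A U (suc k)) (#Between-< A U k<∣A∣) ⟩
    #Between A U (suc k)                         ∎

#Between≡C : (A U : Subset n) → A ⊆ U → ∀ j → #Between A U (∣ A ∣ + j) ≡ (∣ U ∣ ∸ ∣ A ∣) C j
#Between≡C [] [] _ zero    = refl
#Between≡C [] [] _ (suc j) = refl
#Between≡C (inside ∷ A) (outside ∷ U) A⊆U j = contradiction (A⊆U here) λ ()
#Between≡C (inside ∷ A) (inside ∷ U) A⊆U j =
  trans (#Between-in∷in A U (∣ A ∣ + j)) (#Between≡C A U (drop-∷-⊆ A⊆U) j)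
#Between≡C (outside ∷ A) (outside ∷ U) A⊆U j =
  trans (#Between-out∷out A U (∣ A ∣ + j)) (#Between≡C A U (drop-∷-⊆ A⊆U) j)
#Between≡C (outside ∷ A) (inside ∷ U) A⊆U zero =
  trans (#Between-out∷in-≤ A U (∣ A ∣ + 0) (≤-reflexive (+-identityʳ ∣ A ∣)))
        (#Between≡C A U (drop-∷-⊆ A⊆U) zero)
#Between≡C (outside ∷ A) (inside ∷ U) A⊆U (suc j) = begin
  #Between (outside ∷ A) (inside ∷ U) (∣ A ∣ + suc j)
    ≡⟨ cong (#Between (outside ∷ A) (inside ∷ U)) (+-suc ∣ A ∣ j) ⟩
  #Between (outside ∷ A) (inside ∷ U) (suc (∣ A ∣ + j))
    ≡⟨ #Between-out∷in A U (∣ A ∣ + j) ⟩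
  #Between A U (∣ A ∣ + j) + #Between A U (suc (∣ A ∣ + j))
    ≡⟨ cong₂ _+_ (#Between≡C A U A⊆U′ j)
                 (trans (cong (#Between A U) (sym (+-suc ∣ A ∣ j))) (#Between≡C A U A⊆U′ (suc j))) ⟩
  (∣ U ∣ ∸ ∣ A ∣) C j + (∣ U ∣ ∸ ∣ A ∣) C suc j
    ≡⟨ nCk+nC[k+1]≡[n+1]C[k+1] (∣ U ∣ ∸ ∣ A ∣) j ⟩
  suc (∣ U ∣ ∸ ∣ A ∣) C suc j
    ≡⟨ cong (_C suc j) (sym (+-∸-assoc 1 (p⊆q⇒∣p∣≤∣q∣ A⊆U′))) ⟩
  (suc ∣ U ∣ ∸ ∣ A ∣) C suc j ∎
  where
  open ≡-Reasoning
  A⊆U′ = drop-∷-⊆ A⊆U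

#Between-card : (A U : Subset n) {a u : ℕ} → A ⊆ U → ∣ A ∣ ≡ a → ∣ U ∣ ≡ u →
                ∀ j → #Between A U (a + j) ≡ (u ∸ a) C j
#Between-card A U A⊆U refl refl = #Between≡C A U A⊆U

2[n∸3]<3n∸12 : 9 ≤ n → (n ∸ 3) + (n ∸ 3) < 3 * n ∸ 12
2[n∸3]<3n∸12 9≤n with m≤n⇒∃[o]m+o≡n 9≤n
... | t , refl = begin-strict
  (6 + t) + (6 + t)                            <⟨ m<m+n _ (s≤s z≤n) ⟩
  (6 + t) + (6 + t) + (3 + t)                  ≡⟨ sym (m+n∸m≡n 12 _) ⟩
  12 + ((6 + t) + (6 + t) + (3 + t)) ∸ 12      ≡⟨ cong (_∸ 12) (expand t) ⟩
  3 * (9 + t) ∸ 12                             ∎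
  where
  open ≤-Reasoning
  expand : ∀ t → 12 + ((6 + t) + (6 + t) + (3 + t)) ≡ 3 * (9 + t)
  expand = solve-∀

suc-C2 : ∀ m → suc m C 2 ≡ m + m C 2
suc-C2 m = trans (sym (nCk+nC[k+1]≡[n+1]C[k+1] m 1)) (cong (_+ m C 2) (nC1≡n m))

[n∸2]C2≡[3n∸12]+[n∸5]C2 : 5 ≤ n → (n ∸ 2) C 2 ≡ (3 * n ∸ 12) + (n ∸ 5) C 2
[n∸2]C2≡[3n∸12]+[n∸5]C2 5≤n with m≤n⇒∃[o]m+o≡n 5≤n
... | f , refl = begin
  (3 + f) C 2                                  ≡⟨ suc-C2 (2 + f) ⟩
  (2 + f) + (2 + f) C 2                        ≡⟨ cong ((2 + f) +_) (suc-C2 (1 + f)) ⟩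
  (2 + f) + ((1 + f) + (1 + f) C 2)            ≡⟨ cong (λ c → (2 + f) + ((1 + f) + c)) (suc-C2 f) ⟩
  (2 + f) + ((1 + f) + (f + f C 2))            ≡⟨ collect f (f C 2) ⟩
  (3 + 3 * f) + f C 2                          ≡⟨ cong (_+ f C 2) (sym (m+n∸m≡n 12 _)) ⟩
  (12 + (3 + 3 * f)) ∸ 12 + f C 2              ≡⟨ cong (λ m → m ∸ 12 + f C 2) (expand f) ⟩
  (3 * (5 + f) ∸ 12) + f C 2                   ∎
  where
  open ≡-Reasoning
  collect : ∀ f c → (2 + f) + ((1 + f) + (f + c)) ≡ (3 + 3 * f) + c
  collect = solve-∀
  expand : ∀ f → 12 + (3 + 3 * f) ≡ 3 * (5 + f)
  expand = solve-∀

∣p∣≡suc⇒Nonempty : (p : Subset n) → ∣ p ∣ ≡ suc k → Nonempty p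
∣p∣≡suc⇒Nonempty (inside ∷ p)  _ = zero , here
∣p∣≡suc⇒Nonempty (outside ∷ p) ∣p∣≡1+k = Product.map suc there (∣p∣≡suc⇒Nonempty p ∣p∣≡1+k)

∣⁅x⁆∪p∣≡1+∣p∣ : {x : Fin n} (p : Subset n) → x ∉ p → ∣ ⁅ x ⁆ ∪ p ∣ ≡ suc ∣ p ∣
∣⁅x⁆∪p∣≡1+∣p∣ {x = zero}  (inside ∷ p)  x∉p = contradiction here x∉p
∣⁅x⁆∪p∣≡1+∣p∣ {x = zero}  (outside ∷ p) _   = cong (suc ∘ ∣_∣) (∪-identityˡ p)
∣⁅x⁆∪p∣≡1+∣p∣ {x = suc x} (inside ∷ p)  x∉p = cong suc (∣⁅x⁆∪p∣≡1+∣p∣ p (x∉p ∘ there))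
∣⁅x⁆∪p∣≡1+∣p∣ {x = suc x} (outside ∷ p) x∉p = ∣⁅x⁆∪p∣≡1+∣p∣ p (x∉p ∘ there)

∣⁅x⁆∪⁅y⁆∣≡2 : {x y : Fin n} → x ≢ y → ∣ ⁅ x ⁆ ∪ ⁅ y ⁆ ∣ ≡ 2
∣⁅x⁆∪⁅y⁆∣≡2 {y = y} x≢y = trans (∣⁅x⁆∪p∣≡1+∣p∣ ⁅ y ⁆ (x≢y⇒x∉⁅y⁆ x≢y)) (cong suc (∣⁅x⁆∣≡1 y))

⁅x⁆∪p⊆q : {x : Fin n} {p q : Subset n} → x ∈ q → p ⊆ q → ⁅ x ⁆ ∪ p ⊆ q
⁅x⁆∪p⊆q {x = x} {p} {q} x∈q p⊆q y∈ =
  [ (λ y∈⁅x⁆ → subst (_∈ q) (sym (x∈⁅y⁆⇒x≡y x y∈⁅x⁆)) x∈q) , p⊆q ]′ (x∈p∪q⁻ ⁅ x ⁆ p y∈)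

⁅x⁆∪⁅y⁆⊆∁ : {x y : Fin n} {E : Subset n} → x ∉ E → y ∉ E → ⁅ x ⁆ ∪ ⁅ y ⁆ ⊆ ∁ E
⁅x⁆∪⁅y⁆⊆∁ {x = x} {y} x∉E y∉E z∈ with x∈p∪q⁻ ⁅ x ⁆ ⁅ y ⁆ z∈
... | inj₁ z∈⁅x⁆ = subst (_∈ ∁ _) (sym (x∈⁅y⁆⇒x≡y x z∈⁅x⁆)) (x∉p⇒x∈∁p x∉E)
... | inj₂ z∈⁅y⁆ = subst (_∈ ∁ _) (sym (x∈⁅y⁆⇒x≡y y z∈⁅y⁆)) (x∉p⇒x∈∁p y∉E)

module _ {n : ℕ} {F : Family n} {x : Fin n} {E : Subset n}
         (∣E∣≡3 : ∣ E ∣ ≡ 3) (F⊆G3 : ContainedInG3 F x E) where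

  members-meet-E : {G : Subset n} → T (F G) → Nonempty (G ∩ E)
  members-meet-E {G} G∈F with F⊆G3 G G∈F
  ... | _ , inj₁ E⊆G with ∣p∣≡suc⇒Nonempty E ∣E∣≡3
  ...   | i , i∈E = i , x∈p∩q⁺ (E⊆G i∈E , i∈E)
  members-meet-E {G} G∈F | _ , inj₂ (_ , G∩E≠∅) = G∩E≠∅

  deg≤#Between+#Between : (S : Subset n) → deg F S ≤ #Between E ⊤ 4 + #Between (⁅ x ⁆ ∪ S) ⊤ 4
  deg≤#Between+#Between S =
    count≤count+count _ (between? E ⊤ 4) (between? (⁅ x ⁆ ∪ S) ⊤ 4) classify (allSubsets n)
    where
    classify : {G : Subset n} → T (F G) × S ⊆ G → Between E ⊤ 4 G ⊎ Between (⁅ x ⁆ ∪ S) ⊤ 4 G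
    classify {G} (G∈F , S⊆G) with F⊆G3 G G∈F
    ... | ∣G∣≡4 , inj₁ E⊆G       = inj₁ (E⊆G , ⊆⊤ , ∣G∣≡4)
    ... | ∣G∣≡4 , inj₂ (x∈G , _) = inj₂ (⁅x⁆∪p⊆q x∈G S⊆G , ⊆⊤ , ∣G∣≡4)

  deg+#Between≤#Between : (S : Subset n) → deg F S + #Between S (∁ E) 4 ≤ #Between S ⊤ 4
  deg+#Between≤#Between S =
    count+count≤count _ (between? S (∁ E) 4) (between? S ⊤ 4)
      (λ {G} (G∈F , S⊆G) → S⊆G , ⊆⊤ , proj₁ (F⊆G3 G G∈F))
      (λ (S⊆G , _ , ∣G∣≡4) → S⊆G , ⊆⊤ , ∣G∣≡4)
      (λ (G∈F , _) (_ , G⊆∁E , _) → misses G∈F G⊆∁E)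
      (allSubsets n)
    where
    misses : {G : Subset n} → T (F G) → ¬ G ⊆ ∁ E
    misses {G} G∈F G⊆∁E with members-meet-E G∈F
    ... | i , i∈G∩E with x∈p∩q⁻ G E i∈G∩E
    ...   | i∈G , i∈E = x∈p⇒x∉∁p i∈E (G⊆∁E i∈G)

  deg<3n∸12 : 9 ≤ n → {S : Subset n} → ∣ S ∣ ≡ 2 → x ∉ S → deg F S < 3 * n ∸ 12
  deg<3n∸12 9≤n {S} ∣S∣≡2 x∉S = begin-strict
    deg F S                                    ≤⟨ deg≤#Between+#Between S ⟩
    #Between E ⊤ 4 + #Between (⁅ x ⁆ ∪ S) ⊤ 4
      ≡⟨ cong₂ _+_ (#Between-card E ⊤ ⊆⊤ ∣E∣≡3 (∣⊤∣≡n n) 1)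
                   (#Between-card (⁅ x ⁆ ∪ S) ⊤ ⊆⊤ (trans (∣⁅x⁆∪p∣≡1+∣p∣ S x∉S) (cong suc ∣S∣≡2)) (∣⊤∣≡n n) 1) ⟩
    (n ∸ 3) C 1 + (n ∸ 3) C 1                  ≡⟨ cong₂ _+_ (nC1≡n (n ∸ 3)) (nC1≡n (n ∸ 3)) ⟩
    (n ∸ 3) + (n ∸ 3)                          <⟨ 2[n∸3]<3n∸12 9≤n ⟩
    3 * n ∸ 12                                 ∎
    where open ≤-Reasoning

  deg≤3n∸12 : 5 ≤ n → {S : Subset n} → ∣ S ∣ ≡ 2 → S ⊆ ∁ E → deg F S ≤ 3 * n ∸ 12
  deg≤3n∸12 5≤n {S} ∣S∣≡2 S⊆∁E = +-cancelʳ-≤ ((n ∸ 5) C 2) (deg F S) (3 * n ∸ 12) (begin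
    deg F S + (n ∸ 5) C 2                      ≡⟨ cong (deg F S +_) (sym #outside-E) ⟩
    deg F S + #Between S (∁ E) 4               ≤⟨ deg+#Between≤#Between S ⟩
    #Between S ⊤ 4                             ≡⟨ #Between-card S ⊤ ⊆⊤ ∣S∣≡2 (∣⊤∣≡n n) 2 ⟩
    (n ∸ 2) C 2                                ≡⟨ [n∸2]C2≡[3n∸12]+[n∸5]C2 5≤n ⟩
    (3 * n ∸ 12) + (n ∸ 5) C 2                 ∎)
    where
    open ≤-Reasoning
    #outside-E : #Between S (∁ E) 4 ≡ (n ∸ 5) C 2
    #outside-E = trans (#Between-card S (∁ E) S⊆∁E ∣S∣≡2 (trans (∣∁p∣≡n∸∣p∣ E) (cong (n ∸_) ∣E∣≡3)) 2)
                       (cong (_C 2) (∸-+-assoc n 3 2))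

  center∈pair : 9 ≤ n → {x₁ x₂ : Fin n} → x₁ ≢ x₂ →
                3 * n ∸ 12 ≤ deg F (⁅ x₁ ⁆ ∪ ⁅ x₂ ⁆) → x ≡ x₁ ⊎ x ≡ x₂
  center∈pair 9≤n {x₁} {x₂} x₁≢x₂ large with x ∈? (⁅ x₁ ⁆ ∪ ⁅ x₂ ⁆)
  ... | yes x∈S = Sum.map (x∈⁅y⁆⇒x≡y x₁) (x∈⁅y⁆⇒x≡y x₂) (x∈p∪q⁻ ⁅ x₁ ⁆ ⁅ x₂ ⁆ x∈S)
  ... | no x∉S  = contradiction large (<⇒≱ (deg<3n∸12 9≤n (∣⁅x⁆∪⁅y⁆∣≡2 x₁≢x₂) x∉S))

  partner∈B : 5 ≤ n → x ∉ E → {y : Fin n} → x ≢ y →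
              3 * n ∸ 12 < deg F (⁅ x ⁆ ∪ ⁅ y ⁆) → y ∈ ⁅ x ⁆ ∪ E
  partner∈B 5≤n x∉E {y} x≢y larger with y ∈? E
  ... | yes y∈E = x∈p∪q⁺ (inj₂ y∈E)
  ... | no y∉E  = contradiction (deg≤3n∸12 5≤n (∣⁅x⁆∪⁅y⁆∣≡2 x≢y) (⁅x⁆∪⁅y⁆⊆∁ x∉E y∉E)) (<⇒≱ larger)

  pair⊆B : 9 ≤ n → x ∉ E → {x₁ x₂ : Fin n} → x₁ ≢ x₂ →
           3 * n ∸ 12 < deg F (⁅ x₁ ⁆ ∪ ⁅ x₂ ⁆) → x₁ ∈ ⁅ x ⁆ ∪ E × x₂ ∈ ⁅ x ⁆ ∪ E
  pair⊆B 9≤n x∉E {x₁} {x₂} x₁≢x₂ larger with center∈pair 9≤n x₁≢x₂ (<⇒≤ larger)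
  ... | inj₁ refl = x∈p∪q⁺ (inj₁ (x∈⁅x⁆ x)) , partner∈B (≤-trans (m≤m+n 5 4) 9≤n) x∉E x₁≢x₂ larger
  ... | inj₂ refl = partner∈B (≤-trans (m≤m+n 5 4) 9≤n) x∉E (≢-sym x₁≢x₂)
                      (subst (λ S → 3 * n ∸ 12 < deg F S) (∪-comm ⁅ x₁ ⁆ ⁅ x ⁆) larger)
                  , x∈p∪q⁺ (inj₁ (x∈⁅x⁆ x))

claim3p2 : (n : ℕ) → 9 ≤ n → (F : Family n) → Uniform4 F →
    (x : Fin n) (E : Subset n) → ∣ E ∣ ≡ 3 → x ∉ E → ContainedInG3 F x E →
    (x₁ x₂ : Fin n) → x₁ ≢ x₂ →
    ((3 * n ∸ 12 ≤ deg F (⁅ x₁ ⁆ ∪ ⁅ x₂ ⁆) → (x ≡ x₁ ⊎ x ≡ x₂))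
    × (3 * n ∸ 12 < deg F (⁅ x₁ ⁆ ∪ ⁅ x₂ ⁆) →
        ((x₁ ∈ (⁅ x ⁆ ∪ E) × x₂ ∈ (⁅ x ⁆ ∪ E)) × (x ≡ x₁ ⊎ x ≡ x₂))))
claim3p2 n 9≤n F _ x E ∣E∣≡3 x∉E F⊆G3 x₁ x₂ x₁≢x₂ =
  center∈pair ∣E∣≡3 F⊆G3 9≤n x₁≢x₂ ,
  λ larger → pair⊆B ∣E∣≡3 F⊆G3 9≤n x∉E x₁≢x₂ larger , center∈pair ∣E∣≡3 F⊆G3 9≤n x₁≢x₂ (<⇒≤ larger)
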